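{- Let $r,s$ be coprime positive integers and let $t$ be the nonnegative integer with $tr<s\le (t+1)r$. Then $|Q_n^{r/s}|=|\widetilde R_{n+t+1}^{r/s}|$ for every $n\ge0$ (i.e. $Q_n^{r/s}$ and $\widetilde R_{n+t+1}^{r/s}$ are in bijection for all $n\ge 0$) if and only if $s=tr+1$.
   Context: Let $\mathcal D$ be the set of Dyck paths of height at most $2$: words over $\{U,D\}$ ($U=(1,1)$, $D=(1,-1)$) from $(0,0)$ to $(2n,0)$ never going below the $x$-axis and whose $U$ steps reach ordinate at most $2$; $n$ is the semilength, and the empty path $\varepsilon$ has semilength $0$. Every nonempty $P\in\mathcal D$ has the form $UwD$ where $w$ is a word in the factors $UD$ and $DU$; grouping $w$ into maximal runs gives the factorization $P=U(UD)^{p_1}(DU)^{v_1}(UD)^{p_2}(DU)^{v_2}\cdots(UD)^{p_k}(DU)^{v_k}D$, where $p_1\ge0$ and $v_k\ge0$ may be zero and all other exponents are positive; for $P=UD$ one has $k=0$. $\widetilde R_n^{r/s}$ is the set of paths $P\in\mathcal D$ of semilength $n$ such that, for every $i=1,\dots,k$, $p_i\le r$ and $v_i\ge\lceil p_i s/r\rceil$. $Q_n^{r/s}$ is the set of paths $P\in\mathcal D$ of semilength $n$ such that: $p_i\le r$ for all $i=1,\dots,k$; $v_i\ge\lceil p_i s/r\rceil$ for $i=1,\dots,k-1$; and for $i=k$: if $p_k=r$ then $v_k\ge0$ is arbitrary, while if $p_k<r$ then either $v_k=0$ or $v_k\ge\lceil p_k s/r\rceil$. -}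

module Defs where

open import Data.Nat using (ℕ; zero; suc; _+_; _*_; _≡ᵇ_; _<ᵇ_; _≤ᵇ_)
open import Data.Nat.DivMod using (_/_)
open import Data.Bool using (Bool; true; false; _∧_; _∨_; if_then_else_; T)
open import Data.List using (List; []; _∷_; length)
open import Data.Maybe using (Maybe; just; nothing)
open import Data.Product using (Σ; _×_; _,_)
open import Relation.Binary.PropositionalEquality using (_≡_)

-- Steps U = (1,1), D = (1,-1); a lattice path is a word (list) of steps.
data Step : Set where
  U D : Step

Path : Set
Path = List Step

dyckFrom : ℕ → Path → Bool
dyckFrom h [] = h ≡ᵇ 0
dyckFrom h (U ∷ xs) = (h <ᵇ 2) ∧ dyckFrom (suc h) xs
dyckFrom zero (D ∷ xs) = false
dyckFrom (suc h) (D ∷ xs) = dyckFrom h xs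

inD : Path → Bool
inD P = dyckFrom 0 P

data Factor : Set where
  UD DU : Factor

innerFactors : Path → Maybe (List Factor)
innerFactors (D ∷ []) = just []
innerFactors (U ∷ D ∷ xs) with innerFactors xs
... | just fs = just (UD ∷ fs)
... | nothing = nothing
innerFactors (D ∷ U ∷ xs) with innerFactors xs
... | just fs = just (DU ∷ fs)
... | nothing = nothing
innerFactors _ = nothing

-- Group a word in UD, DU into maximal runs:
-- (UD)^{p₁}(DU)^{v₁}⋯(UD)^{p_k}(DU)^{v_k}, returned as [(p₁,v₁),…,(p_k,v_k)]
-- with p₁ ≥ 0, v_k ≥ 0, all other exponents positive (k = 0 for the empty word).
Block : Set
Block = ℕ × ℕ

runs : List Factor → List Block
runs [] = []
runs (UD ∷ fs) with runs fs
... | [] = (1 , 0) ∷ []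
... | (p , v) ∷ bs = (suc p , v) ∷ bs
runs (DU ∷ fs) with runs fs
... | [] = (0 , 1) ∷ []
... | (zero , v) ∷ bs = (0 , suc v) ∷ bs
... | (suc p , v) ∷ bs = (0 , 1) ∷ (suc p , v) ∷ bs

factorization : Path → Maybe (List Block)
factorization (U ∷ xs) with innerFactors xs
... | just fs = just (runs fs)
... | nothing = nothing
factorization _ = nothing

-- ⌈ a / b ⌉ for b > 0 (value 0 for b = 0, never used).
⌈_/_⌉ : ℕ → ℕ → ℕ
⌈ a / zero ⌉ = 0
⌈ a / suc b ⌉ = (a + b) / suc b

blockOK : ℕ → ℕ → Block → Bool
blockOK r s (p , v) = (p ≤ᵇ r) ∧ (⌈ p * s / r ⌉ ≤ᵇ v)

lastBlockOK : ℕ → ℕ → Block → Bool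
lastBlockOK r s (p , v) =
  (p ≤ᵇ r) ∧ (if p ≡ᵇ r then true else ((v ≡ᵇ 0) ∨ (⌈ p * s / r ⌉ ≤ᵇ v)))

qBlocks : ℕ → ℕ → List Block → Bool
qBlocks r s [] = true
qBlocks r s (b ∷ []) = lastBlockOK r s b
qBlocks r s (b ∷ b′ ∷ bs) = blockOK r s b ∧ qBlocks r s (b′ ∷ bs)

allB : {A : Set} → (A → Bool) → List A → Bool
allB f [] = true
allB f (x ∷ xs) = f x ∧ allB f xs

rCond : ℕ → ℕ → Path → Bool
rCond r s [] = true
rCond r s P@(_ ∷ _) with factorization P
... | just bs = allB (blockOK r s) bs
... | nothing = false

qCond : ℕ → ℕ → Path → Bool
qCond r s [] = true
qCond r s P@(_ ∷ _) with factorization P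
... | just bs = qBlocks r s bs
... | nothing = false

R̃ : ℕ → ℕ → ℕ → Set
R̃ r s n = Σ Path (λ P → length P ≡ 2 * n × T (inD P ∧ rCond r s P))

Q : ℕ → ℕ → ℕ → Set
Q r s n = Σ Path (λ P → length P ≡ 2 * n × T (inD P ∧ qCond r s P))

module Submission where

-- A path of 𝒟 of semilength m + 1 is U w D for a word w of length m in UD and DU, i.e. a list of
-- blocks (p_i , v_i) of total size m, and both R̃ and Q only constrain the blocks. Removing t + 1
-- from the last block maps R̃_{m+t+2} injectively into Q_{m+1}: subtract it from v_k when
-- v_k − t − 1 ≥ ⌈p_k s/r⌉, and otherwise spill the remaining size y into the saturated block
-- (UD)^min(y,r) (DU)^(y−r), which is allowed last in Q; the first exponent is recovered as the
-- first p whose window [p + ⌈ps/r⌉ − t − 1 , p + ⌈ps/r⌉) contains y. Consecutive windows touch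
-- exactly when ⌈(p+1)s/r⌉ − ⌈ps/r⌉ ≤ t for all 1 ≤ p < r, i.e. when s = tr + 1; then the map is onto.
-- Otherwise some size lies in no window, the map misses a saturated block, and since Q_{m+1} is
-- finite it cannot be equinumerous with R̃_{m+t+2}. For n = 0 both sides are singletons.

open import Defs
open import Data.Bool using (Bool; true; false; _∧_; if_then_else_; T)
open import Data.Bool.Properties using (T-≡; T-∧; T-∨; T-irrelevant; ∧-assoc; ∧-identityʳ)
open import Data.Empty using (⊥; ⊥-elim)
open import Data.Fin as Fin using (Fin)
open import Data.Fin.Properties using (+↔⊎; injective⇒≤)
open import Data.List using (List; []; _∷_; [_]; _++_; _∷ʳ_; length; replicate; map; drop; initLast; _∷ʳ′_)
open import Data.List.Properties using (length-++; length-replicate; map-++; ∷ʳ-injective)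
open import Data.Maybe using (just)
open import Data.Maybe.Properties using (just-injective)
open import Data.Nat using (ℕ; zero; suc; _+_; _*_; _∸_; _⊓_; _<_; _≤_; _≤ᵇ_; _≡ᵇ_; z≤n; s≤s; _≟_; _≤?_; _<?_)
open import Data.Nat.Coprimality using (Coprime)
open import Data.Nat.DivMod using (_/_; _%_; m≡m%n+[m/n]*n; m%n<n; m/n*n≤m)
open import Data.Nat.ListAction using (sum)
open import Data.Nat.ListAction.Properties using (sum-++)
open import Data.Nat.Properties
open import Data.Nat.Solver using (module +-*-Solver)
open import Data.Product using (Σ; ∃; ∃₂; _×_; _,_; proj₁; proj₂)
open import Data.Product.Function.NonDependent.Propositional using (_×-⇔_)
open import Data.Sum using (_⊎_; inj₁; inj₂; [_,_]′)
open import Data.Sum.Function.Propositional using (_⊎-⇔_; _⊎-↔_)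
open import Data.Unit using (⊤; tt)
open import Function using (_∘_; id)
open import Function.Bundles using (_↔_; _⇔_; mk↔ₛ′; mk⇔; Equivalence; Inverse; Injection)
open import Function.Construct.Composition using (_⇔-∘_; _↔-∘_)
open import Function.Construct.Identity using (⇔-id)
open import Function.Construct.Symmetry using (↔-sym)
open import Function.Definitions using (Injective)
open import Function.Properties.Inverse using (↔⇒↣)
open import Relation.Nullary using (¬_; Dec; yes; no)
open import Relation.Nullary.Decidable using (_×-dec_)
open import Relation.Binary.PropositionalEquality
  using (_≡_; _≢_; refl; sym; trans; cong; cong₂; subst; subst₂; module ≡-Reasoning)

encode : List Factor → Path
encode [] = []
encode (UD ∷ w) = U ∷ D ∷ encode w
encode (DU ∷ w) = D ∷ U ∷ encode w

wrap : List Factor → Path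
wrap w = U ∷ encode w ++ [ D ]

innerFactors-encode : ∀ w → innerFactors (encode w ++ [ D ]) ≡ just w
innerFactors-encode [] = refl
innerFactors-encode (UD ∷ w) rewrite innerFactors-encode w = refl
innerFactors-encode (DU ∷ w) rewrite innerFactors-encode w = refl

factorization-wrap : ∀ w → factorization (wrap w) ≡ just (runs w)
factorization-wrap w rewrite innerFactors-encode w = refl

inD-wrap : ∀ w → T (inD (wrap w))
inD-wrap w = subst T (sym (dyck w)) tt
  where
  dyck : ∀ w → dyckFrom 1 (encode w ++ [ D ]) ≡ true
  dyck [] = refl
  dyck (UD ∷ w) = dyck w
  dyck (DU ∷ w) = dyck w

-- Below height 2, a path from height 1 steps to height 0 or 2 and straight back, so it spells
-- a word in UD and DU followed by a final D.
decode : ∀ xs → T (dyckFrom 1 xs) → ∃ λ w → xs ≡ encode w ++ [ D ]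
decode (D ∷ []) _ = [] , refl
decode (U ∷ D ∷ xs) h with decode xs h
... | w , refl = UD ∷ w , refl
decode (D ∷ U ∷ xs) h with decode xs h
... | w , refl = DU ∷ w , refl

wrap-surjective : ∀ P → T (inD P) → 0 < length P → ∃ λ w → P ≡ wrap w
wrap-surjective (U ∷ xs) h _ with decode xs h
... | w , refl = w , refl

length-wrap : ∀ w → length (wrap w) ≡ 2 * suc (length w)
length-wrap w = begin
  suc (length (encode w ++ [ D ]))  ≡⟨ cong suc (length-++ (encode w)) ⟩
  suc (length (encode w) + 1)       ≡⟨ cong suc (+-comm (length (encode w)) 1) ⟩
  suc (suc (length (encode w)))     ≡⟨ cong (suc ∘ suc) (length-encode w) ⟩
  2 + 2 * length w                  ≡⟨ sym (*-distribˡ-+ 2 1 (length w)) ⟩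
  2 * suc (length w)                ∎
  where
  open ≡-Reasoning
  length-encode : ∀ w → length (encode w) ≡ 2 * length w
  length-encode [] = refl
  length-encode (UD ∷ w) = trans (cong (2 +_) (length-encode w)) (sym (*-distribˡ-+ 2 1 (length w)))
  length-encode (DU ∷ w) = trans (cong (2 +_) (length-encode w)) (sym (*-distribˡ-+ 2 1 (length w)))

Subset : {A : Set} → (A → ℕ) → ℕ → (A → Bool) → Set
Subset {A} ℓ n C = Σ A λ a → ℓ a ≡ n × T (C a)

Subset-≡ : ∀ {A : Set} {ℓ : A → ℕ} {n C} {x y : Subset ℓ n C} → proj₁ x ≡ proj₁ y → x ≡ y
Subset-≡ {x = a , l , c} {.a , l′ , c′} refl rewrite ≡-irrelevant l l′ | T-irrelevant c c′ = refl

-- Q r s n and R̃ r s n are, definitionally, Paths (qCond r s) n and Paths (rCond r s) n.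
Paths : (Path → Bool) → ℕ → Set
Paths C n = Subset length (2 * n) (λ P → inD P ∧ C P)

Words : (List Factor → Bool) → ℕ → Set
Words C m = Subset length m C

wrap-injective : ∀ {w w′} → wrap w ≡ wrap w′ → w ≡ w′
wrap-injective {w} {w′} e = just-injective (begin
  just w                                ≡⟨ sym (innerFactors-encode w) ⟩
  innerFactors (encode w ++ [ D ])      ≡⟨ cong (innerFactors ∘ drop 1) e ⟩
  innerFactors (encode w′ ++ [ D ])     ≡⟨ innerFactors-encode w′ ⟩
  just w′                               ∎)
  where open ≡-Reasoning

paths↔words : ∀ (C : Path → Bool) (C′ : List Factor → Bool) → (∀ w → C (wrap w) ≡ C′ w) →
              ∀ m → Paths C (suc m) ↔ Words C′ m
paths↔words C C′ C≡C′ m = mk↔ₛ′ to from to∘from from∘to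
  where
  decoded : (x : Paths C (suc m)) → ∃ λ w → proj₁ x ≡ wrap w
  decoded (P , length≡ , sat) =
    wrap-surjective P (proj₁ (Equivalence.to T-∧ sat)) (subst (0 <_) (sym length≡) (s≤s z≤n))

  to : Paths C (suc m) → Words C′ m
  to x@(P , length≡ , sat) with decoded x
  ... | w , refl = w ,
    suc-injective (*-cancelˡ-≡ _ _ 2 (trans (sym (length-wrap w)) length≡)) ,
    subst T (C≡C′ w) (proj₂ (Equivalence.to T-∧ sat))

  to-word : ∀ x → proj₁ x ≡ wrap (proj₁ (to x))
  to-word x with decoded x
  ... | w , refl = refl

  from : Words C′ m → Paths C (suc m)
  from (w , length≡ , sat) = wrap w , trans (length-wrap w) (cong (λ n → 2 * suc n) length≡) ,
    Equivalence.from T-∧ (inD-wrap w , subst T (sym (C≡C′ w)) sat)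

  to∘from : ∀ x → to (from x) ≡ x
  to∘from x = Subset-≡ (sym (wrap-injective (to-word (from x))))

  from∘to : ∀ x → from (to x) ≡ x
  from∘to x = Subset-≡ (sym (to-word x))

size : Block → ℕ
size (p , v) = p + v

weight : List Block → ℕ
weight = sum ∘ map size

weight-∷ʳ : ∀ bs b → weight (bs ∷ʳ b) ≡ weight bs + size b
weight-∷ʳ bs b = begin
  sum (map size (bs ++ [ b ]))         ≡⟨ cong sum (map-++ size bs [ b ]) ⟩
  sum (map size bs ++ [ size b ])      ≡⟨ sum-++ (map size bs) [ size b ] ⟩
  weight bs + (size b + 0)             ≡⟨ cong (weight bs +_) (+-identityʳ (size b)) ⟩
  weight bs + size b                   ∎
  where open ≡-Reasoning

flatten : List Block → List Factor
flatten [] = []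
flatten ((p , v) ∷ bs) = replicate p UD ++ replicate v DU ++ flatten bs

length-flatten : ∀ bs → length (flatten bs) ≡ weight bs
length-flatten [] = refl
length-flatten ((p , v) ∷ bs) = begin
  length (replicate p UD ++ replicate v DU ++ flatten bs)
    ≡⟨ length-++ (replicate p UD) ⟩
  length (replicate p UD) + length (replicate v DU ++ flatten bs)
    ≡⟨ cong₂ _+_ (length-replicate p) (length-++ (replicate v DU)) ⟩
  p + (length (replicate v DU) + length (flatten bs))
    ≡⟨ cong₂ (λ a b → p + (a + b)) (length-replicate v) (length-flatten bs) ⟩
  p + (v + weight bs)
    ≡⟨ sym (+-assoc p v (weight bs)) ⟩
  p + v + weight bs ∎
  where open ≡-Reasoning

-- runs w, except that the empty word gets the single block (0 , 0), so every word has a last block.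
blocks : List Factor → List Block
blocks [] = (0 , 0) ∷ []
blocks w@(_ ∷ _) = runs w

push : Factor → List Block → List Block
push UD [] = (1 , 0) ∷ []
push UD ((p , v) ∷ bs) = (suc p , v) ∷ bs
push DU [] = (0 , 1) ∷ []
push DU ((zero , v) ∷ bs) = (0 , suc v) ∷ bs
push DU ((suc p , v) ∷ bs) = (0 , 1) ∷ (suc p , v) ∷ bs

runs-∷ : ∀ f w → runs (f ∷ w) ≡ push f (runs w)
runs-∷ UD w with runs w
... | [] = refl
... | _ ∷ _ = refl
runs-∷ DU w with runs w
... | [] = refl
... | (zero , _) ∷ _ = refl
... | (suc _ , _) ∷ _ = refl

blocks-∷ : ∀ f w → blocks (f ∷ w) ≡ push f (blocks w)
blocks-∷ UD [] = refl
blocks-∷ DU [] = refl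
blocks-∷ f w@(_ ∷ _) = runs-∷ f w

-- In a factorization every exponent except p₁ and v_k is positive; CanonicalAfter v bs says that
-- bs may follow a block (_ , v).
CanonicalAfter : ℕ → List Block → Set
CanonicalAfter v [] = ⊤
CanonicalAfter v ((p , v′) ∷ bs) = 1 ≤ v × 1 ≤ p × CanonicalAfter v′ bs

Canonical : List Block → Set
Canonical [] = ⊥
Canonical ((p , v) ∷ bs) = CanonicalAfter v bs

canonicalAfter-irrelevant : ∀ v bs (c c′ : CanonicalAfter v bs) → c ≡ c′
canonicalAfter-irrelevant v [] tt tt = refl
canonicalAfter-irrelevant v ((p , v′) ∷ bs) (a , b , c) (a′ , b′ , c′) =
  cong₂ _,_ (≤-irrelevant a a′) (cong₂ _,_ (≤-irrelevant b b′) (canonicalAfter-irrelevant v′ bs c c′))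

canonical-irrelevant : ∀ bs (c c′ : Canonical bs) → c ≡ c′
canonical-irrelevant ((p , v) ∷ bs) = canonicalAfter-irrelevant v bs

canonicalAfter-suc : ∀ v bs → CanonicalAfter v bs → CanonicalAfter (suc v) bs
canonicalAfter-suc v [] _ = tt
canonicalAfter-suc v (_ ∷ _) (_ , c) = s≤s z≤n , c

canonical-push : ∀ f bs → Canonical bs → Canonical (push f bs)
canonical-push UD ((p , v) ∷ bs) c = c
canonical-push DU ((zero , v) ∷ bs) c = canonicalAfter-suc v bs c
canonical-push DU ((suc p , v) ∷ bs) c = s≤s z≤n , s≤s z≤n , c

canonical-blocks : ∀ w → Canonical (blocks w)
canonical-blocks [] = tt
canonical-blocks (f ∷ w) =
  subst Canonical (sym (blocks-∷ f w)) (canonical-push f (blocks w) (canonical-blocks w))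

flatten-push : ∀ f bs → flatten (push f bs) ≡ f ∷ flatten bs
flatten-push UD [] = refl
flatten-push UD ((p , v) ∷ bs) = refl
flatten-push DU [] = refl
flatten-push DU ((zero , v) ∷ bs) = refl
flatten-push DU ((suc p , v) ∷ bs) = refl

flatten-blocks : ∀ w → flatten (blocks w) ≡ w
flatten-blocks [] = refl
flatten-blocks (f ∷ w) = begin
  flatten (blocks (f ∷ w))       ≡⟨ cong flatten (blocks-∷ f w) ⟩
  flatten (push f (blocks w))    ≡⟨ flatten-push f (blocks w) ⟩
  f ∷ flatten (blocks w)         ≡⟨ cong (f ∷_) (flatten-blocks w) ⟩
  f ∷ w                          ∎
  where open ≡-Reasoning

blocks-UDs : ∀ p w {q v bs} → blocks w ≡ (q , v) ∷ bs →
             blocks (replicate p UD ++ w) ≡ (p + q , v) ∷ bs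
blocks-UDs zero w e = e
blocks-UDs (suc p) w e = trans (blocks-∷ UD (replicate p UD ++ w)) (cong (push UD) (blocks-UDs p w e))

blocks-DUs-onto-DU : ∀ n w {v bs} → blocks w ≡ (0 , v) ∷ bs →
                     blocks (replicate n DU ++ w) ≡ (0 , n + v) ∷ bs
blocks-DUs-onto-DU zero w e = e
blocks-DUs-onto-DU (suc n) w e =
  trans (blocks-∷ DU (replicate n DU ++ w)) (cong (push DU) (blocks-DUs-onto-DU n w e))

blocks-DUs-onto-UD : ∀ n w {q v bs} → blocks w ≡ (suc q , v) ∷ bs →
                     blocks (replicate (suc n) DU ++ w) ≡ (0 , suc n) ∷ (suc q , v) ∷ bs
blocks-DUs-onto-UD zero w e = trans (blocks-∷ DU w) (cong (push DU) e)
blocks-DUs-onto-UD (suc n) w e =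
  trans (blocks-∷ DU (replicate (suc n) DU ++ w)) (cong (push DU) (blocks-DUs-onto-UD n w e))

blocks-flatten-∷ : ∀ p v bs → CanonicalAfter v bs → blocks (flatten ((p , v) ∷ bs)) ≡ (p , v) ∷ bs
blocks-flatten-∷ p v [] _ =
  trans (blocks-UDs p (replicate v DU ++ []) (blocks-DUs-onto-DU v [] refl))
        (cong₂ (λ a b → (a , b) ∷ []) (+-identityʳ p) (+-identityʳ v))
blocks-flatten-∷ p (suc v) ((suc q , v′) ∷ bs) (_ , _ , c) =
  trans (blocks-UDs p _ (blocks-DUs-onto-UD v (flatten ((suc q , v′) ∷ bs)) (blocks-flatten-∷ (suc q) v′ bs c)))
        (cong (λ a → (a , suc v) ∷ (suc q , v′) ∷ bs) (+-identityʳ p))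

blocks-flatten : ∀ bs → Canonical bs → blocks (flatten bs) ≡ bs
blocks-flatten ((p , v) ∷ bs) = blocks-flatten-∷ p v bs

-- The condition Canonical (bs ∷ʳ b) places on the last block b.
Final : List Block → Block → Set
Final [] _ = ⊤
Final (_ ∷ _) (p , _) = 1 ≤ p

canonical⇒∷ʳ : ∀ xs → Canonical xs → ∃₂ λ bs b → xs ≡ bs ∷ʳ b
canonical⇒∷ʳ xs c with initLast xs
... | bs ∷ʳ′ b = bs , b , refl

canonicalAfter-final : ∀ v bs {b} → CanonicalAfter v (bs ∷ʳ b) → 1 ≤ proj₁ b
canonicalAfter-final v [] (_ , p≥1 , _) = p≥1
canonicalAfter-final v ((_ , v′) ∷ bs) (_ , _ , c) = canonicalAfter-final v′ bs c

canonical-final : ∀ bs {b} → Canonical (bs ∷ʳ b) → Final bs b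
canonical-final [] _ = tt
canonical-final ((_ , v) ∷ bs) c = canonicalAfter-final v bs c

canonicalAfter-replaceLast : ∀ v bs {b b′} → CanonicalAfter v (bs ∷ʳ b) → 1 ≤ proj₁ b′ →
                             CanonicalAfter v (bs ∷ʳ b′)
canonicalAfter-replaceLast v [] (v≥1 , _) p′≥1 = v≥1 , p′≥1 , tt
canonicalAfter-replaceLast v ((_ , v′) ∷ bs) (v≥1 , p≥1 , c) p′≥1 =
  v≥1 , p≥1 , canonicalAfter-replaceLast v′ bs c p′≥1

canonical-replaceLast : ∀ bs {b b′} → Canonical (bs ∷ʳ b) → Final bs b′ → Canonical (bs ∷ʳ b′)
canonical-replaceLast [] _ _ = tt
canonical-replaceLast ((_ , v) ∷ bs) c f = canonicalAfter-replaceLast v bs c f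

final-map : ∀ bs {b b′} → Final bs b → (1 ≤ proj₁ b → 1 ≤ proj₁ b′) → Final bs b′
final-map [] _ _ = tt
final-map (_ ∷ _) f g = g f

weight-replaceLast : ∀ bs {b b′ d} → size b′ ≡ size b + d → weight (bs ∷ʳ b′) ≡ weight (bs ∷ʳ b) + d
weight-replaceLast bs {b} {b′} {d} e = begin
  weight (bs ∷ʳ b′)        ≡⟨ weight-∷ʳ bs b′ ⟩
  weight bs + size b′      ≡⟨ cong (weight bs +_) e ⟩
  weight bs + (size b + d) ≡⟨ sym (+-assoc (weight bs) (size b) d) ⟩
  weight bs + size b + d   ≡⟨ cong (_+ d) (sym (weight-∷ʳ bs b)) ⟩
  weight (bs ∷ʳ b) + d     ∎
  where open ≡-Reasoning

allB-∷ʳ : ∀ {A : Set} (f : A → Bool) xs x → allB f (xs ∷ʳ x) ≡ allB f xs ∧ f x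
allB-∷ʳ f [] x = ∧-identityʳ (f x)
allB-∷ʳ f (y ∷ xs) x = trans (cong (f y ∧_) (allB-∷ʳ f xs x)) (sym (∧-assoc (f y) _ _))

qBlocks-∷ʳ : ∀ r s bs b → qBlocks r s (bs ∷ʳ b) ≡ allB (blockOK r s) bs ∧ lastBlockOK r s b
qBlocks-∷ʳ r s [] b = refl
qBlocks-∷ʳ r s (b′ ∷ []) b = cong (_∧ lastBlockOK r s b) (sym (∧-identityʳ (blockOK r s b′)))
qBlocks-∷ʳ r s (b′ ∷ b″ ∷ bs) b =
  trans (cong (blockOK r s b′ ∧_) (qBlocks-∷ʳ r s (b″ ∷ bs) b)) (sym (∧-assoc (blockOK r s b′) _ _))

record BlockList (C : List Block → Bool) (m : ℕ) : Set where
  constructor blockList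
  field
    init      : List Block
    last      : Block
    canonical : Canonical (init ∷ʳ last)
    weight≡   : weight (init ∷ʳ last) ≡ m
    satisfies : T (C (init ∷ʳ last))

BlockList-≡ : ∀ {C m} {x y : BlockList C m} →
              BlockList.init x ≡ BlockList.init y → BlockList.last x ≡ BlockList.last y → x ≡ y
BlockList-≡ {x = blockList bs b c w s} {blockList .bs .b c′ w′ s′} refl refl
  rewrite canonical-irrelevant (bs ∷ʳ b) c c′ | ≡-irrelevant w w′ | T-irrelevant s s′ = refl

weight-blocks : ∀ w → weight (blocks w) ≡ length w
weight-blocks w = trans (sym (length-flatten (blocks w))) (cong length (flatten-blocks w))

words↔blockLists : ∀ (C : List Block → Bool) m → Words (C ∘ blocks) m ↔ BlockList C m
words↔blockLists C m = mk↔ₛ′ to from to∘from from∘to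
  where
  open BlockList

  to : Words (C ∘ blocks) m → BlockList C m
  to (w , length≡ , sat) with canonical⇒∷ʳ (blocks w) (canonical-blocks w)
  ... | bs , b , e = record
    { init = bs
    ; last = b
    ; canonical = subst Canonical e (canonical-blocks w)
    ; weight≡ = trans (cong weight (sym e)) (trans (weight-blocks w) length≡)
    ; satisfies = subst (T ∘ C) e sat
    }

  to-blocks : ∀ x → init (to x) ∷ʳ last (to x) ≡ blocks (proj₁ x)
  to-blocks (w , _) with canonical⇒∷ʳ (blocks w) (canonical-blocks w)
  ... | _ , _ , e = sym e

  from : BlockList C m → Words (C ∘ blocks) m
  from x = flatten xs , trans (length-flatten xs) (weight≡ x) ,
           subst (T ∘ C) (sym (blocks-flatten xs (canonical x))) (satisfies x)
    where xs = init x ∷ʳ last x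

  to∘from : ∀ x → to (from x) ≡ x
  to∘from x = BlockList-≡ (proj₁ same) (proj₂ same)
    where
    same = ∷ʳ-injective (init (to (from x))) (init x)
             (trans (to-blocks (from x)) (blocks-flatten (init x ∷ʳ last x) (canonical x)))

  from∘to : ∀ x → from (to x) ≡ x
  from∘to x = Subset-≡ (trans (cong flatten (to-blocks x)) (flatten-blocks (proj₁ x)))

Finite : Set → Set
Finite A = ∃ λ k → A ↔ Fin k

finite-paths : ∀ N (C : Path → Bool) → Finite (Subset length N C)
finite-paths zero C with C [] in eq
... | true = 1 , mk↔ₛ′ (λ _ → Fin.zero) (λ _ → [] , refl , subst T (sym eq) tt) (λ { Fin.zero → refl ; (Fin.suc ()) })
                       (λ { ([] , refl , _) → Subset-≡ refl })
... | false = 0 , mk↔ₛ′ (λ { ([] , refl , c) → ⊥-elim (subst T eq c) }) (λ ()) (λ ())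
                       (λ { ([] , refl , c) → ⊥-elim (subst T eq c) })
finite-paths (suc N) C with finite-paths N (C ∘ (U ∷_)) | finite-paths N (C ∘ (D ∷_))
... | a , paths-U | b , paths-D = a + b , (↔-sym (+↔⊎ {a} {b}) ↔-∘ (paths-U ⊎-↔ paths-D)) ↔-∘ byFirstStep
  where
  byFirstStep : Subset length (suc N) C ↔ (Subset length N (C ∘ (U ∷_)) ⊎ Subset length N (C ∘ (D ∷_)))
  byFirstStep = mk↔ₛ′ to from to∘from from∘to
    where
    to : Subset length (suc N) C → Subset length N (C ∘ (U ∷_)) ⊎ Subset length N (C ∘ (D ∷_))
    to (U ∷ P , length≡ , c) = inj₁ (P , suc-injective length≡ , c)
    to (D ∷ P , length≡ , c) = inj₂ (P , suc-injective length≡ , c)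
    from : Subset length N (C ∘ (U ∷_)) ⊎ Subset length N (C ∘ (D ∷_)) → Subset length (suc N) C
    from (inj₁ (P , length≡ , c)) = U ∷ P , cong suc length≡ , c
    from (inj₂ (P , length≡ , c)) = D ∷ P , cong suc length≡ , c
    to∘from : ∀ x → to (from x) ≡ x
    to∘from (inj₁ _) = cong inj₁ (Subset-≡ refl)
    to∘from (inj₂ _) = cong inj₂ (Subset-≡ refl)
    from∘to : ∀ x → from (to x) ≡ x
    from∘to (U ∷ _ , _) = Subset-≡ refl
    from∘to (D ∷ _ , _) = Subset-≡ refl

injective⇒¬missing : ∀ {A B : Set} → Finite A → A ↔ B → (f : B → A) → Injective _≡_ _≡_ f →
                     (a : A) → ¬ (∀ b → f b ≢ a)
injective⇒¬missing {A} (k , A↔Fin) A↔B f f-injective a missing = n≮n k (injective⇒≤ F-injective)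
  where
  index = Inverse.to A↔Fin
  element = Inverse.from A↔Fin
  index-injective = Injection.injective (↔⇒↣ A↔Fin)
  element-injective = Injection.injective (↔⇒↣ (↔-sym A↔Fin))
  F : Fin (suc k) → Fin k
  F Fin.zero = index a
  F (Fin.suc i) = index (f (Inverse.to A↔B (element i)))
  F-injective : ∀ {i j} → F i ≡ F j → i ≡ j
  F-injective {Fin.zero} {Fin.zero} _ = refl
  F-injective {Fin.zero} {Fin.suc j} e = ⊥-elim (missing _ (sym (index-injective e)))
  F-injective {Fin.suc i} {Fin.zero} e = ⊥-elim (missing _ (index-injective e))
  F-injective {Fin.suc i} {Fin.suc j} e =
    cong Fin.suc (element-injective (Injection.injective (↔⇒↣ A↔B) (f-injective (index-injective e))))

*<*+⇒≤ : ∀ x y r′ → x * suc r′ < y * suc r′ + suc r′ → x ≤ y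
*<*+⇒≤ x y r′ h = m<1+n⇒m≤n (*-cancelʳ-< (suc r′) x (suc y) (subst (x * suc r′ <_) (+-comm (y * suc r′) (suc r′)) h))

⌈/⌉-lower : ∀ a r′ → a ≤ ⌈ a / suc r′ ⌉ * suc r′
⌈/⌉-lower a r′ = +-cancelʳ-≤ r′ a _ (begin
  a + r′                      ≡⟨ m≡m%n+[m/n]*n (a + r′) (suc r′) ⟩
  (a + r′) % suc r′ + q * suc r′ ≤⟨ +-monoˡ-≤ (q * suc r′) (m<1+n⇒m≤n (m%n<n (a + r′) (suc r′))) ⟩
  r′ + q * suc r′             ≡⟨ +-comm r′ (q * suc r′) ⟩
  q * suc r′ + r′             ∎)
  where
  open ≤-Reasoning
  q = (a + r′) / suc r′

⌈/⌉-upper : ∀ a r′ → ⌈ a / suc r′ ⌉ * suc r′ < a + suc r′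
⌈/⌉-upper a r′ = ≤-<-trans (m/n*n≤m (a + r′) (suc r′)) (+-monoʳ-< a ≤-refl)

⌈/⌉-unique : ∀ a r′ k → a ≤ k * suc r′ → k * suc r′ < a + suc r′ → ⌈ a / suc r′ ⌉ ≡ k
⌈/⌉-unique a r′ k a≤kr kr<a+r = ≤-antisym
  (*<*+⇒≤ _ k r′ (<-≤-trans (⌈/⌉-upper a r′) (+-monoˡ-≤ (suc r′) a≤kr)))
  (*<*+⇒≤ k _ r′ (<-≤-trans kr<a+r (+-monoˡ-≤ (suc r′) (⌈/⌉-lower a r′))))

T-≤ᵇ : ∀ {m n} → T (m ≤ᵇ n) ⇔ m ≤ n
T-≤ᵇ {m} {n} = mk⇔ (≤ᵇ⇒≤ m n) ≤⇒≤ᵇ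

T-≡ᵇ : ∀ {m n} → T (m ≡ᵇ n) ⇔ m ≡ n
T-≡ᵇ {m} {n} = mk⇔ (≡ᵇ⇒≡ m n) (≡⇒≡ᵇ m n)

T-if : ∀ c {x} → T (if c then true else x) ⇔ (T c ⊎ T x)
T-if true = mk⇔ inj₁ (λ _ → tt)
T-if false = mk⇔ inj₂ [ (λ ()) , id ]′

module _ (f : ℕ → ℕ) (y : ℕ) where

  firstAbove : ℕ → ℕ → ℕ
  firstAbove i zero = i
  firstAbove i (suc n) with y <? f i
  ... | yes _ = i
  ... | no _ = firstAbove (suc i) n

  record IsFirstAbove (i n j : ℕ) : Set where
    field
      lower : i ≤ j
      upper : j ≤ i + n
      above : y < f j ⊎ j ≡ i + n
      below : ∀ k → i ≤ k → k < j → f k ≤ y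

  firstAbove-spec : ∀ i n → IsFirstAbove i n (firstAbove i n)
  firstAbove-spec i zero = record
    { lower = ≤-refl
    ; upper = m≤m+n i 0
    ; above = inj₂ (sym (+-identityʳ i))
    ; below = λ k i≤k k<i → ⊥-elim (<⇒≱ k<i i≤k)
    }
  firstAbove-spec i (suc n) with y <? f i
  ... | yes y<fi = record
    { lower = ≤-refl
    ; upper = m≤m+n i (suc n)
    ; above = inj₁ y<fi
    ; below = λ k i≤k k<i → ⊥-elim (<⇒≱ k<i i≤k)
    }
  ... | no y≮fi = record
    { lower = <⇒≤ lower
    ; upper = subst (firstAbove (suc i) n ≤_) (sym (+-suc i n)) upper
    ; above = [ inj₁ , (λ e → inj₂ (trans e (sym (+-suc i n)))) ]′ above
    ; below = below′
    }
    where
    open IsFirstAbove (firstAbove-spec (suc i) n)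
    below′ : ∀ k → i ≤ k → k < firstAbove (suc i) n → f k ≤ y
    below′ k i≤k k<j with m≤n⇒m<n∨m≡n i≤k
    ... | inj₁ i<k = below k i<k k<j
    ... | inj₂ refl = ≮⇒≥ y≮fi

  isFirstAbove-unique : ∀ {i n j j′} → IsFirstAbove i n j → IsFirstAbove i n j′ → y < f j → j′ ≡ j
  isFirstAbove-unique {j = j} {j′} J J′ y<fj = ≤-antisym
    (≮⇒≥ (λ j<j′ → <⇒≱ y<fj (IsFirstAbove.below J′ j (IsFirstAbove.lower J) j<j′)))
    (≮⇒≥ j′≮j)
    where
    j′≮j : ¬ j′ < j
    j′≮j j′<j with IsFirstAbove.above J′
    ... | inj₁ y<fj′ = <⇒≱ y<fj′ (IsFirstAbove.below J j′ (IsFirstAbove.lower J′) j′<j)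
    ... | inj₂ j′≡i+n = <⇒≱ j′<j (subst (j ≤_) (sym j′≡i+n) (IsFirstAbove.upper J))

Q₀↔⊤ : ∀ r s → Q r s 0 ↔ ⊤
Q₀↔⊤ r s = mk↔ₛ′ (λ _ → tt) (λ _ → [] , refl , tt) (λ _ → refl) (λ { ([] , refl , _) → Subset-≡ refl })

module Slope (r′ s t : ℕ) (t*r<s : t * suc r′ < s) (s≤[1+t]r : s ≤ suc t * suc r′) where

  r : ℕ
  r = suc r′

  vmin : ℕ → ℕ
  vmin p = ⌈ p * s / r ⌉

  vmin-unique : ∀ p k → p * s ≤ k * r → k * r < p * s + r → vmin p ≡ k
  vmin-unique p = ⌈/⌉-unique (p * s) r′

  vmin-zero : vmin 0 ≡ 0
  vmin-zero = vmin-unique 0 0 z≤n (s≤s z≤n)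

  vmin-one : vmin 1 ≡ suc t
  vmin-one = vmin-unique 1 (suc t)
    (subst (_≤ suc t * r) (sym (*-identityˡ s)) s≤[1+t]r)
    (subst (suc t * r <_) (cong (_+ r) (sym (*-identityˡ s))) (subst (_< s + r) (+-comm (t * r) r) (+-monoˡ-< r t*r<s)))

  vmin-r : vmin r ≡ s
  vmin-r = vmin-unique r s (≤-reflexive (*-comm r s))
    (subst (s * r <_) (cong (_+ r) (*-comm s r)) (m<m+n (s * r) (s≤s z≤n)))

  vmin-step : ∀ p → vmin p + t ≤ vmin (suc p)
  vmin-step p = *<*+⇒≤ (vmin p + t) (vmin (suc p)) r′ (begin-strict
    (vmin p + t) * r         ≡⟨ *-distribʳ-+ r (vmin p) t ⟩
    vmin p * r + t * r       <⟨ +-mono-<-≤ (⌈/⌉-upper (p * s) r′) (<⇒≤ t*r<s) ⟩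
    p * s + r + s            ≡⟨ +-assoc (p * s) r s ⟩
    p * s + (r + s)          ≡⟨ cong (p * s +_) (+-comm r s) ⟩
    p * s + (s + r)          ≡⟨ sym (+-assoc (p * s) s r) ⟩
    p * s + s + r            ≡⟨ cong (_+ r) (+-comm (p * s) s) ⟩
    suc p * s + r            ≤⟨ +-monoˡ-≤ r (⌈/⌉-lower (suc p * s) r′) ⟩
    vmin (suc p) * r + r     ∎)
    where open ≤-Reasoning

  vmin-mono : ∀ {p q} → p ≤ q → vmin p ≤ vmin q
  vmin-mono {p} {q} p≤q = subst (λ q → vmin p ≤ vmin q) (m+[n∸m]≡n p≤q) (go (q ∸ p))
    where
    go : ∀ d → vmin p ≤ vmin (p + d)
    go zero = ≤-reflexive (cong vmin (sym (+-identityʳ p)))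
    go (suc d) = ≤-trans (go d) (≤-trans (m≤m+n _ t)
                   (subst (λ x → vmin (p + d) + t ≤ vmin x) (sym (+-suc p d)) (vmin-step (p + d))))

  vmin-positive : ∀ {p} → 1 ≤ p → suc t ≤ vmin p
  vmin-positive {p} 1≤p = subst (_≤ vmin p) vmin-one (vmin-mono 1≤p)

  minSize : ℕ → ℕ
  minSize p = p + vmin p

  minSize-step : ∀ p → minSize p + suc t ≤ minSize (suc p)
  minSize-step p = begin
    p + vmin p + suc t      ≡⟨ +-suc (p + vmin p) t ⟩
    suc (p + vmin p + t)    ≡⟨ cong suc (+-assoc p (vmin p) t) ⟩
    suc p + (vmin p + t)    ≤⟨ +-monoʳ-≤ (suc p) (vmin-step p) ⟩
    minSize (suc p)         ∎
    where open ≤-Reasoning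

  minSize-mono : ∀ {p q} → p ≤ q → minSize p ≤ minSize q
  minSize-mono p≤q = +-mono-≤ p≤q (vmin-mono p≤q)

  minSize-< : ∀ {p q} → p < q → minSize p + suc t ≤ minSize q
  minSize-< {p} {suc q} (s≤s p≤q) = ≤-trans (+-monoˡ-≤ (suc t) (minSize-mono p≤q)) (minSize-step q)

  -- The sizes into which shorten (below) spills admissible blocks with first exponent p.
  Window : ℕ → ℕ → Set
  Window p y = minSize p ≤ y + suc t × y < minSize p

  firstIndex : ℕ → ℕ
  firstIndex y = firstAbove minSize y 1 r′

  window⇒firstIndex : ∀ {p y} → 1 ≤ p → p ≤ r → Window p y → firstIndex y ≡ p
  window⇒firstIndex {p} {y} 1≤p p≤r (p-low , p-high) =
    isFirstAbove-unique minSize y isFirst (firstAbove-spec minSize y 1 r′) p-high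
    where
    isFirst : IsFirstAbove minSize y 1 r′ p
    isFirst = record
      { lower = 1≤p
      ; upper = p≤r
      ; above = inj₁ p-high
      ; below = λ k _ k<p → +-cancelʳ-≤ (suc t) _ _ (≤-trans (minSize-< k<p) p-low)
      }

  Admissible : Block → Set
  Admissible (p , v) = p ≤ r × vmin p ≤ v

  LastAdmissible : Block → Set
  LastAdmissible (p , v) = p ≤ r × (p ≡ r ⊎ v ≡ 0 ⊎ vmin p ≤ v)

  blockOK⇔admissible : ∀ b → T (blockOK r s b) ⇔ Admissible b
  blockOK⇔admissible (p , v) = (T-≤ᵇ ×-⇔ T-≤ᵇ) ⇔-∘ T-∧

  lastBlockOK⇔lastAdmissible : ∀ b → T (lastBlockOK r s b) ⇔ LastAdmissible b
  lastBlockOK⇔lastAdmissible (p , v) =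
    (T-≤ᵇ ×-⇔ ((T-≡ᵇ ⊎-⇔ ((T-≡ᵇ ⊎-⇔ T-≤ᵇ) ⇔-∘ T-∨)) ⇔-∘ T-if (p ≡ᵇ r))) ⇔-∘ T-∧

  admissible? : ∀ b → Dec (Admissible b)
  admissible? (p , v) = p ≤? r ×-dec vmin p ≤? v

  admissible-flat : ∀ v → Admissible (0 , v)
  admissible-flat v = z≤n , subst (_≤ v) (sym vmin-zero) z≤n

  admissible-large : ∀ {p v} → 1 ≤ p → Admissible (p , v) → suc t < p + v
  admissible-large 1≤p (_ , vmin≤v) = +-mono-≤ 1≤p (≤-trans (vmin-positive 1≤p) vmin≤v)

  admissible⇒last : ∀ {b} → Admissible b → LastAdmissible b
  admissible⇒last {p , v} (p≤r , vmin≤v) = p≤r , inj₂ (inj₂ vmin≤v)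

  -- The block of size y with the largest first exponent allowed by p ≤ r.
  saturated : ℕ → Block
  saturated y = (r ⊓ y , y ∸ r)

  size-saturated : ∀ y → size (saturated y) ≡ y
  size-saturated = m⊓n+n∸m≡n r

  saturated-injective : ∀ {y y′} → saturated y ≡ saturated y′ → y ≡ y′
  saturated-injective {y} {y′} e = trans (sym (size-saturated y)) (trans (cong size e) (size-saturated y′))

  saturated-≤ : ∀ {y} → y ≤ r → saturated y ≡ (y , 0)
  saturated-≤ y≤r = cong₂ _,_ (m≥n⇒m⊓n≡n y≤r) (m≤n⇒m∸n≡0 y≤r)

  saturated-≥ : ∀ {y} → r ≤ y → saturated y ≡ (r , y ∸ r)
  saturated-≥ {y} r≤y = cong (_, y ∸ r) (m≤n⇒m⊓n≡m r≤y)

  saturated-UD : ∀ {y} → 1 ≤ y → 1 ≤ proj₁ (saturated y)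
  saturated-UD 1≤y = ⊓-glb (s≤s z≤n) 1≤y

  saturated-lastAdmissible : ∀ y → LastAdmissible (saturated y)
  saturated-lastAdmissible y with ≤-total y r
  ... | inj₁ y≤r = subst LastAdmissible (sym (saturated-≤ y≤r)) (y≤r , inj₂ (inj₁ refl))
  ... | inj₂ r≤y = subst LastAdmissible (sym (saturated-≥ r≤y)) (≤-refl , inj₁ refl)

  saturated-¬admissible : ∀ {y} → 1 ≤ y → y < r + s → ¬ Admissible (saturated y)
  saturated-¬admissible {y} 1≤y y<r+s adm with ≤-total y r
  ... | inj₁ y≤r = <⇒≱ (vmin-positive 1≤y) (≤-trans (proj₂ (subst Admissible (saturated-≤ y≤r) adm)) z≤n)
  ... | inj₂ r≤y = <⇒≱ (+-cancelˡ-< r _ _ (subst (_< r + s) (sym (m+[n∸m]≡n r≤y)) y<r+s))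
                       (subst (_≤ y ∸ r) vmin-r (proj₂ (subst Admissible (saturated-≥ r≤y) adm)))

  lastAdmissible⇒saturated : ∀ {p v} → LastAdmissible (p , v) → ¬ Admissible (p , v) →
                             1 ≤ p × (p , v) ≡ saturated (p + v) × p + v < r + s
  lastAdmissible⇒saturated {p} {v} (_ , inj₁ refl) ¬adm =
    s≤s z≤n , sym (trans (saturated-≥ (m≤m+n r v)) (cong (r ,_) (m+n∸m≡n r v))) , +-monoʳ-< r v<s
    where
    v<s : v < s
    v<s = subst (v <_) vmin-r (≰⇒> (λ vmin≤v → ¬adm (≤-refl , vmin≤v)))
  lastAdmissible⇒saturated {p} (p≤r , inj₂ (inj₁ refl)) ¬adm =
    1≤p , sym (trans (cong saturated (+-identityʳ p)) (saturated-≤ p≤r)) ,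
    ≤-<-trans (≤-reflexive (+-identityʳ p)) (≤-<-trans p≤r (m<m+n r (≤-<-trans z≤n t*r<s)))
    where
    1≤p : 1 ≤ p
    1≤p = n≢0⇒n>0 (λ { refl → ¬adm (admissible-flat 0) })
  lastAdmissible⇒saturated (p≤r , inj₂ (inj₂ vmin≤v)) ¬adm = ⊥-elim (¬adm (p≤r , vmin≤v))

  shorten : Block → Block
  shorten (p , v) with vmin p + suc t ≤? v
  ... | yes _ = (p , v ∸ suc t)
  ... | no _ = saturated (p + v ∸ suc t)

  data Shortening (p v : ℕ) : Block → Set where
    trim  : vmin p + suc t ≤ v → Shortening p v (p , v ∸ suc t)
    spill : 1 ≤ p → p ≤ r → Window p (p + v ∸ suc t) → Shortening p v (saturated (p + v ∸ suc t))

  shortening : ∀ {p v} → Admissible (p , v) → suc t ≤ p + v → Shortening p v (shorten (p , v))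
  shortening {p} {v} (p≤r , vmin≤v) large with vmin p + suc t ≤? v
  ... | yes long = trim long
  ... | no short = spill 1≤p p≤r (low , high)
    where
    1≤p : 1 ≤ p
    1≤p = n≢0⇒n>0 (λ { refl → short (subst (λ x → x + suc t ≤ v) (sym vmin-zero) large) })
    y+t+1≡ : p + v ∸ suc t + suc t ≡ p + v
    y+t+1≡ = m∸n+n≡m large
    low : minSize p ≤ p + v ∸ suc t + suc t
    low = subst (minSize p ≤_) (sym y+t+1≡) (+-monoʳ-≤ p vmin≤v)
    high : p + v ∸ suc t < minSize p
    high = +-cancelʳ-< (suc t) _ _ (subst₂ _<_ (sym y+t+1≡) (sym (+-assoc p (vmin p) (suc t)))
                                      (+-monoʳ-< p (≰⇒> short)))

  trim-admissible : ∀ {p v} → vmin p + suc t ≤ v → p ≤ r → Admissible (p , v ∸ suc t)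
  trim-admissible long p≤r = p≤r , m+n≤o⇒m≤o∸n _ long

  window-bounds : ∀ {p y} → 1 ≤ p → p ≤ r → Window p y → 1 ≤ y × y < r + s
  window-bounds {p} {y} 1≤p p≤r (low , high) =
    +-cancelʳ-≤ (suc t) 1 y (≤-trans (+-mono-≤ 1≤p (vmin-positive 1≤p)) low) ,
    <-≤-trans high (subst (minSize p ≤_) (cong (r +_) vmin-r) (minSize-mono p≤r))

  size-shorten : ∀ {p v} → Admissible (p , v) → suc t ≤ p + v → size (shorten (p , v)) + suc t ≡ p + v
  size-shorten {p} {v} adm large with shorten (p , v) | shortening adm large
  ... | _ | trim long = trans (+-assoc p (v ∸ suc t) (suc t)) (cong (p +_) (m∸n+n≡m (≤-trans (m≤n+m (suc t) (vmin p)) long)))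
  ... | _ | spill _ _ _ = trans (cong (_+ suc t) (size-saturated _)) (m∸n+n≡m large)

  shorten-lastAdmissible : ∀ {p v} → Admissible (p , v) → suc t ≤ p + v → LastAdmissible (shorten (p , v))
  shorten-lastAdmissible {p} {v} adm large with shorten (p , v) | shortening adm large
  ... | _ | trim long = admissible⇒last (trim-admissible long (proj₁ adm))
  ... | _ | spill _ _ _ = saturated-lastAdmissible _

  shorten-UD : ∀ {p v} → Admissible (p , v) → suc t ≤ p + v → 1 ≤ p → 1 ≤ proj₁ (shorten (p , v))
  shorten-UD {p} {v} adm large 1≤p with shorten (p , v) | shortening adm large
  ... | _ | trim _ = 1≤p
  ... | _ | spill _ p≤r w = saturated-UD (proj₁ (window-bounds 1≤p p≤r w))

  -- The admissible block of size y + suc t whose shortening spills into saturated y.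
  spillSource : ℕ → Block
  spillSource y = (firstIndex y , y + suc t ∸ firstIndex y)

  extend : Block → Block
  extend (p , v) with admissible? (p , v)
  ... | yes _ = (p , v + suc t)
  ... | no _ = spillSource (p + v)

  data Extension (p v : ℕ) : Block → Set where
    untrim  : Admissible (p , v) → Extension p v (p , v + suc t)
    unspill : 1 ≤ p → (p , v) ≡ saturated (p + v) → p + v < r + s → Extension p v (spillSource (p + v))

  extension : ∀ {p v} → LastAdmissible (p , v) → Extension p v (extend (p , v))
  extension {p} {v} last with admissible? (p , v)
  ... | yes adm = untrim adm
  ... | no ¬adm with lastAdmissible⇒saturated last ¬adm
  ...   | 1≤p , sat , small = unspill 1≤p sat small

  extend-untrims : ∀ {p v} → Admissible (p , v) → extend (p , v) ≡ (p , v + suc t)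
  extend-untrims {p} {v} adm with admissible? (p , v)
  ... | yes _ = refl
  ... | no ¬adm = ⊥-elim (¬adm adm)

  extend-saturated : ∀ {y} → 1 ≤ y → y < r + s → extend (saturated y) ≡ spillSource y
  extend-saturated {y} 1≤y y<r+s with admissible? (saturated y)
  ... | yes adm = ⊥-elim (saturated-¬admissible 1≤y y<r+s adm)
  ... | no _ = cong spillSource (size-saturated y)

  extend-shorten : ∀ {p v} → Admissible (p , v) → suc t ≤ p + v → extend (shorten (p , v)) ≡ (p , v)
  extend-shorten {p} {v} adm large with shorten (p , v) | shortening adm large
  ... | _ | trim long = trans (extend-untrims (trim-admissible long (proj₁ adm)))
                              (cong (p ,_) (m∸n+n≡m (≤-trans (m≤n+m (suc t) (vmin p)) long)))
  ... | _ | spill 1≤p p≤r w = begin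
    extend (saturated y)                ≡⟨ extend-saturated 1≤y y<r+s ⟩
    spillSource y                       ≡⟨ cong (λ q → (q , y + suc t ∸ q)) (window⇒firstIndex 1≤p p≤r w) ⟩
    (p , y + suc t ∸ p)                 ≡⟨ cong (λ n → (p , n ∸ p)) (m∸n+n≡m large) ⟩
    (p , p + v ∸ p)                     ≡⟨ cong (p ,_) (m+n∸m≡n p v) ⟩
    (p , v)                             ∎
    where
    open ≡-Reasoning
    y = p + v ∸ suc t
    1≤y = proj₁ (window-bounds 1≤p p≤r w)
    y<r+s = proj₂ (window-bounds 1≤p p≤r w)

  T-allAdmissible-∷ʳ : ∀ bs b → T (allB (blockOK r s) (bs ∷ʳ b)) ⇔ (T (allB (blockOK r s) bs) × Admissible b)
  T-allAdmissible-∷ʳ bs b rewrite allB-∷ʳ (blockOK r s) bs b = (⇔-id _ ×-⇔ blockOK⇔admissible b) ⇔-∘ T-∧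

  T-qBlocks-∷ʳ : ∀ bs b → T (qBlocks r s (bs ∷ʳ b)) ⇔ (T (allB (blockOK r s) bs) × LastAdmissible b)
  T-qBlocks-∷ʳ bs b rewrite qBlocks-∷ʳ r s bs b = (⇔-id _ ×-⇔ lastBlockOK⇔lastAdmissible b) ⇔-∘ T-∧

  last-admissible : ∀ bs {b} → T (allB (blockOK r s) (bs ∷ʳ b)) → Admissible b
  last-admissible bs {b} = proj₂ ∘ Equivalence.to (T-allAdmissible-∷ʳ bs b)

  last-lastAdmissible : ∀ bs {b} → T (qBlocks r s (bs ∷ʳ b)) → LastAdmissible b
  last-lastAdmissible bs {b} = proj₂ ∘ Equivalence.to (T-qBlocks-∷ʳ bs b)

  AdmissibleBlocks : ℕ → Set
  AdmissibleBlocks = BlockList (allB (blockOK r s))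

  QBlocks : ℕ → Set
  QBlocks = BlockList (qBlocks r s)

  last-large : ∀ {m} bs {p v} → Canonical (bs ∷ʳ (p , v)) → weight (bs ∷ʳ (p , v)) ≡ m + suc t →
               Admissible (p , v) → suc t ≤ p + v
  last-large {m} [] _ weight≡ _ = subst (suc t ≤_) (trans (sym weight≡) (+-identityʳ _)) (m≤n+m (suc t) m)
  last-large (b ∷ bs) canonical _ adm = <⇒≤ (admissible-large (canonical-final (b ∷ bs) canonical) adm)

  shortenList : ∀ {m} → AdmissibleBlocks (m + suc t) → QBlocks m
  shortenList {m} (blockList bs (p , v) canonical weight≡ satisfies) = record
    { init = bs
    ; last = shorten (p , v)
    ; canonical = canonical-replaceLast bs canonical (final-map bs (canonical-final bs canonical) (shorten-UD adm large))
    ; weight≡ = +-cancelʳ-≡ (suc t) _ m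
        (trans (sym (weight-replaceLast bs (sym (size-shorten adm large)))) weight≡)
    ; satisfies = Equivalence.from (T-qBlocks-∷ʳ bs _) (init-adm , shorten-lastAdmissible adm large)
    }
    where
    init-adm = proj₁ (Equivalence.to (T-allAdmissible-∷ʳ bs (p , v)) satisfies)
    adm = last-admissible bs satisfies
    large = last-large bs canonical weight≡ adm

  extend-shortenList : ∀ {m} (x : AdmissibleBlocks (m + suc t)) →
                       extend (BlockList.last (shortenList x)) ≡ BlockList.last x
  extend-shortenList (blockList bs (p , v) canonical weight≡ satisfies) =
    extend-shorten adm (last-large bs canonical weight≡ adm)
    where adm = last-admissible bs satisfies

  shortenList-injective : ∀ {m} {x y : AdmissibleBlocks (m + suc t)} → shortenList x ≡ shortenList y → x ≡ y
  shortenList-injective {x = x} {y} e = BlockList-≡ (cong BlockList.init e) (begin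
    BlockList.last x                              ≡⟨ sym (extend-shortenList x) ⟩
    extend (BlockList.last (shortenList x))       ≡⟨ cong (extend ∘ BlockList.last) e ⟩
    extend (BlockList.last (shortenList y))       ≡⟨ extend-shortenList y ⟩
    BlockList.last y                              ∎)
    where open ≡-Reasoning

  -- An admissible block with p ≥ 1 already has size > t.
  weight≡t⇒last-p≡0 : ∀ bs {p v} → T (allB (blockOK r s) (bs ∷ʳ (p , v))) → weight (bs ∷ʳ (p , v)) ≡ t → p ≡ 0
  weight≡t⇒last-p≡0 bs {p} {v} satisfies weight≡ = n≤0⇒n≡0 (≮⇒≥ λ 1≤p →
    <⇒≱ (admissible-large 1≤p (last-admissible bs satisfies))
        (≤-trans size≤t (n≤1+n t)))
    where
    size≤t : p + v ≤ t
    size≤t = begin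
      p + v                  ≤⟨ m≤n+m (p + v) (weight bs) ⟩
      weight bs + (p + v)    ≡⟨ sym (weight-∷ʳ bs (p , v)) ⟩
      weight (bs ∷ʳ (p , v)) ≡⟨ weight≡ ⟩
      t                      ∎
      where open ≤-Reasoning

  admissibleBlocks-unique : (x : AdmissibleBlocks t) → BlockList.init x ≡ [] × BlockList.last x ≡ (0 , t)
  admissibleBlocks-unique (blockList [] (p , v) _ weight≡ satisfies)
    with weight≡t⇒last-p≡0 [] {p} {v} satisfies weight≡
  ... | refl = refl , cong (0 ,_) (trans (sym (+-identityʳ v)) weight≡)
  admissibleBlocks-unique (blockList bs@(_ ∷ _) (p , v) canonical weight≡ satisfies) =
    ⊥-elim (<⇒≱ (subst (1 ≤_) (weight≡t⇒last-p≡0 bs {p} {v} satisfies weight≡) (canonical-final bs canonical)) z≤n)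

  admissibleBlocks↔⊤ : AdmissibleBlocks t ↔ ⊤
  admissibleBlocks↔⊤ = mk↔ₛ′ (λ _ → tt) (λ _ → single) (λ _ → refl)
    (λ x → BlockList-≡ (sym (proj₁ (admissibleBlocks-unique x))) (sym (proj₂ (admissibleBlocks-unique x))))
    where
    single : AdmissibleBlocks t
    single = blockList [] (0 , t) tt (+-identityʳ t)
      (Equivalence.from (T-allAdmissible-∷ʳ [] (0 , t)) (tt , admissible-flat t))

  rCond-wrap : ∀ w → rCond r s (wrap w) ≡ allB (blockOK r s) (blocks w)
  rCond-wrap [] = sym (trans (∧-identityʳ _)
    (Equivalence.to T-≡ (Equivalence.from (blockOK⇔admissible (0 , 0)) (admissible-flat 0))))
  rCond-wrap w@(_ ∷ _) rewrite factorization-wrap w = refl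

  qCond-wrap : ∀ w → qCond r s (wrap w) ≡ qBlocks r s (blocks w)
  qCond-wrap [] = refl
  qCond-wrap w@(_ ∷ _) rewrite factorization-wrap w = refl

  paths↔admissibleBlocks : ∀ m → Paths (rCond r s) (suc m) ↔ AdmissibleBlocks m
  paths↔admissibleBlocks m =
    words↔blockLists (allB (blockOK r s)) m ↔-∘ paths↔words (rCond r s) _ rCond-wrap m

  paths↔qBlocks : ∀ m → Paths (qCond r s) (suc m) ↔ QBlocks m
  paths↔qBlocks m = words↔blockLists (qBlocks r s) m ↔-∘ paths↔words (qCond r s) _ qCond-wrap m
  record Jump : Set where
    field
      p₀     : ℕ
      1≤p₀   : 1 ≤ p₀
      p₀<r   : p₀ < r
      jumps  : vmin p₀ + suc t ≤ vmin (suc p₀)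

  jump-or-slow : ∀ k → suc k ≤ r → Jump ⊎ vmin (suc k) ≤ suc k * t + 1
  jump-or-slow zero _ =
    inj₂ (≤-reflexive (trans vmin-one (trans (+-comm 1 t) (cong (_+ 1) (sym (*-identityˡ t))))))
  jump-or-slow (suc k) k<r with jump-or-slow k (<⇒≤ k<r)
  ... | inj₁ j = inj₁ j
  ... | inj₂ slow with vmin (suc k) + suc t ≤? vmin (suc (suc k))
  ...   | yes jumps = inj₁ (record { p₀ = suc k ; 1≤p₀ = s≤s z≤n ; p₀<r = k<r ; jumps = jumps })
  ...   | no ¬jumps = inj₂ (begin
    vmin (suc (suc k))     ≤⟨ m<1+n⇒m≤n (subst (vmin (suc (suc k)) <_) (+-suc (vmin (suc k)) t) (≰⇒> ¬jumps)) ⟩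
    vmin (suc k) + t       ≤⟨ +-monoˡ-≤ t slow ⟩
    suc k * t + 1 + t      ≡⟨ solve 2 (λ k t → (con 1 :+ k) :* t :+ con 1 :+ t := (con 2 :+ k) :* t :+ con 1) refl k t ⟩
    suc (suc k) * t + 1    ∎)
    where
    open ≤-Reasoning
    open +-*-Solver

  jump-exists : t * r + 2 ≤ s → Jump
  jump-exists t*r+2≤s with jump-or-slow r′ ≤-refl
  ... | inj₁ j = j
  ... | inj₂ slow = ⊥-elim (<⇒≱ (≤-reflexive (sym (+-suc (t * r) 1))) (≤-trans t*r+2≤s s≤tr+1))
    where
    s≤tr+1 : s ≤ t * r + 1
    s≤tr+1 = subst₂ _≤_ vmin-r (cong (_+ 1) (*-comm r t)) slow

  -- A jump of vmin by more than t at p₀ leaves a gap between the windows: no window contains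
  -- minSize p₀, so the saturated block of that size is not a shortening.
  module Gap (J : Jump) where
    open Jump J

    x₀ : ℕ
    x₀ = minSize p₀

    no-window : ∀ p → ¬ Window p x₀
    no-window p (low , high) with p ≤? p₀
    ... | yes p≤p₀ = <⇒≱ high (minSize-mono p≤p₀)
    ... | no p≰p₀ = <⇒≱ (<-≤-trans beyond (minSize-mono (≰⇒> p≰p₀))) low
      where
      beyond : x₀ + suc t < minSize (suc p₀)
      beyond = s≤s (subst (_≤ p₀ + vmin (suc p₀)) (sym (+-assoc p₀ (vmin p₀) (suc t))) (+-monoʳ-≤ p₀ jumps))

    1≤x₀ : 1 ≤ x₀
    1≤x₀ = ≤-trans 1≤p₀ (m≤m+n p₀ (vmin p₀))

    x₀<r+s : x₀ < r + s
    x₀<r+s = <-≤-trans (m<m+n x₀ (s≤s z≤n)) (subst (x₀ + suc t ≤_) (cong (r +_) vmin-r) (minSize-< p₀<r))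

    shorten-avoids : ∀ {p v} → Admissible (p , v) → suc t ≤ p + v → shorten (p , v) ≢ saturated x₀
    shorten-avoids {p} {v} adm large with shorten (p , v) | shortening adm large
    ... | _ | trim long = λ e → saturated-¬admissible 1≤x₀ x₀<r+s (subst Admissible e (trim-admissible long (proj₁ adm)))
    ... | _ | spill _ _ w = λ e → no-window p (subst (Window p) (saturated-injective e) w)

    missed : QBlocks x₀
    missed = blockList [] (saturated x₀) tt (trans (+-identityʳ _) (size-saturated x₀))
      (Equivalence.from (T-qBlocks-∷ʳ [] (saturated x₀)) (tt , saturated-lastAdmissible x₀))

    shortenList-misses : ∀ (x : AdmissibleBlocks (x₀ + suc t)) → shortenList x ≢ missed
    shortenList-misses (blockList bs (p , v) canonical weight≡ satisfies) e =
      shorten-avoids adm (last-large bs canonical weight≡ adm) (cong BlockList.last e)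
      where adm = last-admissible bs satisfies

  module Tight (s≡tr+1 : s ≡ t * r + 1) where

    vmin-tight : ∀ {p} → 1 ≤ p → p ≤ r → vmin p ≡ p * t + 1
    vmin-tight {p} 1≤p p≤r = vmin-unique p (p * t + 1)
      (subst₂ _≤_ (sym ps) (sym kr) (+-monoʳ-≤ (p * t * r) p≤r))
      (subst₂ _<_ (sym kr) (cong (_+ r) (sym ps))
        (≤-trans (+-monoʳ-< (p * t * r) (m<n+m r 1≤p)) (≤-reflexive (sym (+-assoc (p * t * r) p r)))))
      where
      open +-*-Solver
      ps : p * s ≡ p * t * r + p
      ps = trans (cong (p *_) s≡tr+1) (solve 3 (λ p t r → p :* (t :* r :+ con 1) := p :* t :* r :+ p) refl p t r)
      kr : (p * t + 1) * r ≡ p * t * r + r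
      kr = solve 3 (λ p t r → (p :* t :+ con 1) :* r := p :* t :* r :+ r) refl p t r

    minSize-tight-step : ∀ {p} → 1 ≤ p → suc p ≤ r → minSize (suc p) ≡ minSize p + suc t
    minSize-tight-step {p} 1≤p p<r
      rewrite vmin-tight 1≤p (<⇒≤ p<r) | vmin-tight (s≤s z≤n) p<r =
      solve 2 (λ p t → (con 1 :+ p) :+ ((con 1 :+ p) :* t :+ con 1) := p :+ (p :* t :+ con 1) :+ (con 1 :+ t)) refl p t
      where open +-*-Solver

    firstIndex-window : ∀ {y} → 1 ≤ y → y < r + s → 1 ≤ firstIndex y × firstIndex y ≤ r × Window (firstIndex y) y
    firstIndex-window {y} 1≤y y<r+s = lower , upper , reach (firstIndex y) lower upper below , high
      where
      open IsFirstAbove (firstAbove-spec minSize y 1 r′)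
      high : y < minSize (firstIndex y)
      high with above
      ... | inj₁ y<q = y<q
      ... | inj₂ q≡r = subst (λ q → y < minSize q) (sym q≡r) (subst (y <_) (cong (r +_) (sym vmin-r)) y<r+s)
      -- In the tight case consecutive minimal sizes differ by exactly suc t.
      reach : ∀ q → 1 ≤ q → q ≤ r → (∀ k → 1 ≤ k → k < q → minSize k ≤ y) → minSize q ≤ y + suc t
      reach 1 _ _ _ = subst (λ x → 1 + x ≤ y + suc t) (sym vmin-one) (+-monoˡ-≤ (suc t) 1≤y)
      reach (suc (suc q)) _ q<r below′ =
        subst (_≤ y + suc t) (sym (minSize-tight-step (s≤s z≤n) q<r)) (+-monoˡ-≤ (suc t) (below′ (suc q) (s≤s z≤n) ≤-refl))

    module _ {y} (1≤y : 1 ≤ y) (y<r+s : y < r + s) where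
      private
        q = firstIndex y
        window = firstIndex-window 1≤y y<r+s
        q≤y+t+1 : q ≤ y + suc t
        q≤y+t+1 = ≤-trans (m≤m+n q (vmin q)) (proj₁ (proj₂ (proj₂ window)))

      spillSource-admissible : Admissible (spillSource y)
      spillSource-admissible = proj₁ (proj₂ window) ,
        m+n≤o⇒m≤o∸n (vmin q) (subst (_≤ y + suc t) (+-comm q (vmin q)) (proj₁ (proj₂ (proj₂ window))))

      size-spillSource : size (spillSource y) ≡ y + suc t
      size-spillSource = m+[n∸m]≡n q≤y+t+1

      spillSource-UD : 1 ≤ proj₁ (spillSource y)
      spillSource-UD = proj₁ window

      shorten-spillSource : shorten (spillSource y) ≡ saturated y
      shorten-spillSource
        with shorten (spillSource y)
           | shortening spillSource-admissible (subst (suc t ≤_) (sym size-spillSource) (m≤n+m (suc t) y))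
      ... | _ | trim long = ⊥-elim (<⇒≱ (proj₂ (proj₂ (proj₂ window))) (+-cancelʳ-≤ (suc t) _ _ (begin
        q + vmin q + suc t              ≡⟨ +-assoc q (vmin q) (suc t) ⟩
        q + (vmin q + suc t)            ≤⟨ +-monoʳ-≤ q long ⟩
        q + (y + suc t ∸ q)             ≡⟨ size-spillSource ⟩
        y + suc t                       ∎)))
        where open ≤-Reasoning
      ... | _ | spill _ _ _ = cong saturated (trans (cong (_∸ suc t) size-spillSource) (m+n∸n≡m y (suc t)))

    shorten-untrim : ∀ {p v} → Admissible (p , v) → shorten (p , v + suc t) ≡ (p , v)
    shorten-untrim {p} {v} (_ , vmin≤v) with vmin p + suc t ≤? v + suc t
    ... | yes _ = cong (p ,_) (m+n∸n≡m v (suc t))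
    ... | no short = ⊥-elim (short (+-monoˡ-≤ (suc t) vmin≤v))

    size-extend : ∀ {p v} → LastAdmissible (p , v) → size (extend (p , v)) ≡ p + v + suc t
    size-extend {p} {v} last with extend (p , v) | extension last
    ... | _ | untrim _ = sym (+-assoc p v (suc t))
    ... | _ | unspill 1≤p _ small = size-spillSource (≤-trans 1≤p (m≤m+n p v)) small

    extend-admissible : ∀ {p v} → LastAdmissible (p , v) → Admissible (extend (p , v))
    extend-admissible {p} {v} last with extend (p , v) | extension last
    ... | _ | untrim (p≤r , vmin≤v) = p≤r , ≤-trans vmin≤v (m≤m+n v (suc t))
    ... | _ | unspill 1≤p _ small = spillSource-admissible (≤-trans 1≤p (m≤m+n p v)) small

    extend-UD : ∀ {p v} → LastAdmissible (p , v) → 1 ≤ p → 1 ≤ proj₁ (extend (p , v))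
    extend-UD {p} {v} last 1≤p with extend (p , v) | extension last
    ... | _ | untrim _ = 1≤p
    ... | _ | unspill _ _ small = spillSource-UD (≤-trans 1≤p (m≤m+n p v)) small

    shorten-extend : ∀ {p v} → LastAdmissible (p , v) → shorten (extend (p , v)) ≡ (p , v)
    shorten-extend {p} {v} last with extend (p , v) | extension last
    ... | _ | untrim adm = shorten-untrim adm
    ... | _ | unspill 1≤p sat small = trans (shorten-spillSource (≤-trans 1≤p (m≤m+n p v)) small) (sym sat)

    extendList : ∀ {m} → QBlocks m → AdmissibleBlocks (m + suc t)
    extendList {m} (blockList bs (p , v) canonical weight≡ satisfies) = record
      { init = bs
      ; last = extend (p , v)
      ; canonical = canonical-replaceLast bs canonical (final-map bs (canonical-final bs canonical) (extend-UD last))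
      ; weight≡ = trans (weight-replaceLast bs (size-extend last)) (cong (_+ suc t) weight≡)
      ; satisfies = Equivalence.from (T-allAdmissible-∷ʳ bs _) (init-adm , extend-admissible last)
      }
      where
      init-adm = proj₁ (Equivalence.to (T-qBlocks-∷ʳ bs (p , v)) satisfies)
      last = last-lastAdmissible bs satisfies

    shortenList-extendList : ∀ {m} (x : QBlocks m) → shortenList (extendList x) ≡ x
    shortenList-extendList (blockList bs (p , v) canonical weight≡ satisfies) =
      BlockList-≡ refl (shorten-extend (last-lastAdmissible bs satisfies))

    extendList-shortenList : ∀ {m} (x : AdmissibleBlocks (m + suc t)) → extendList (shortenList x) ≡ x
    extendList-shortenList x = BlockList-≡ refl (extend-shortenList x)

    qBlocks↔admissibleBlocks : ∀ m → QBlocks m ↔ AdmissibleBlocks (m + suc t)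
    qBlocks↔admissibleBlocks m = mk↔ₛ′ extendList shortenList extendList-shortenList shortenList-extendList

  tight⇒bijections : s ≡ t * r + 1 → ∀ n → Q r s n ↔ R̃ r s (n + suc t)
  tight⇒bijections _ zero = ↔-sym (paths↔admissibleBlocks t) ↔-∘ (↔-sym admissibleBlocks↔⊤ ↔-∘ Q₀↔⊤ r s)
  tight⇒bijections tight (suc m) =
    ↔-sym (paths↔admissibleBlocks (m + suc t)) ↔-∘ (Tight.qBlocks↔admissibleBlocks tight m ↔-∘ paths↔qBlocks m)

  bijections⇒tight : (∀ n → Q r s n ↔ R̃ r s (n + suc t)) → s ≡ t * r + 1
  bijections⇒tight bijection with s ≟ t * r + 1
  ... | yes tight = tight
  ... | no ¬tight =
    ⊥-elim (injective⇒¬missing finite qBlocks↔admissibleBlocks shortenList shortenList-injective missed shortenList-misses)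
    where
    t*r+2≤s : t * r + 2 ≤ s
    t*r+2≤s = subst (_≤ s) (sym (+-suc (t * r) 1)) (≤∧≢⇒< (subst (_≤ s) (+-comm 1 (t * r)) t*r<s) (¬tight ∘ sym))
    open Gap (jump-exists t*r+2≤s)
    qBlocks↔admissibleBlocks : QBlocks x₀ ↔ AdmissibleBlocks (x₀ + suc t)
    qBlocks↔admissibleBlocks = paths↔admissibleBlocks (x₀ + suc t) ↔-∘ (bijection (suc x₀) ↔-∘ ↔-sym (paths↔qBlocks x₀))
    finite : Finite (QBlocks x₀)
    finite with finite-paths (2 * suc x₀) (λ P → inD P ∧ qCond r s P)
    ... | k , paths↔Fin = k , paths↔Fin ↔-∘ ↔-sym (paths↔qBlocks x₀)

  bijections⇔tight : (∀ n → Q r s n ↔ R̃ r s (n + suc t)) ⇔ (s ≡ t * r + 1)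
  bijections⇔tight = mk⇔ bijections⇒tight tight⇒bijections

proposition7 : (r s t : ℕ) → 0 < r → 0 < s → Coprime r s →
    t * r < s → s ≤ suc t * r →
    ((∀ (n : ℕ) → Q r s n ↔ R̃ r s (n + t + 1)) ⇔ (s ≡ t * r + 1))
proposition7 (suc r′) s t _ _ _ t*r<s s≤[1+t]r =
  mk⇔ (to ∘ reindex n+t+1≡n+[1+t]) (reindex (sym ∘ n+t+1≡n+[1+t]) ∘ from)
  where
  open Equivalence (Slope.bijections⇔tight r′ s t t*r<s s≤[1+t]r)
  n+t+1≡n+[1+t] : ∀ n → n + t + 1 ≡ n + suc t
  n+t+1≡n+[1+t] n = trans (+-assoc n t 1) (cong (n +_) (+-comm t 1))
  reindex : ∀ {i j : ℕ → ℕ} → (∀ n → i n ≡ j n) →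
            (∀ n → Q (suc r′) s n ↔ R̃ (suc r′) s (i n)) → ∀ n → Q (suc r′) s n ↔ R̃ (suc r′) s (j n)
  reindex i≡j bijection n = subst (λ k → Q (suc r′) s n ↔ R̃ (suc r′) s k) (i≡j n) (bijection n)
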